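{- If $G$ is a good graph with $\omega(G)\ge 4$, then $\chi(G)=\omega(G)$.
   Context: All graphs are finite and simple; $\chi$ and $\omega$ denote chromatic number and clique number. For vertex sets $A,B$ of $G$, the edge set $[A,B]$ (edges with one end in $A$ and the other in $B$) is special if each vertex of $A$ is adjacent to at most one vertex of $B$ and each vertex of $B$ is adjacent to at most one vertex of $A$. A pair $\{A,B\}$ is graded if $A$ and $B$ are cliques and $[A,B]$ is special. A graph $G$ is a good graph if $V(G)$ can be partitioned into three cliques $Q_1,Q_2,Q_3$ such that $\{Q_1,Q_2\}$, $\{Q_2,Q_3\}$ and $\{Q_3,Q_1\}$ are graded. -}

module Defs where

open import Level using (Level; 0ℓ)
open import Data.Nat using (ℕ; _<_; _≤_)
open import Data.Fin using (Fin)
open import Data.Product using (Σ; _×_; ∃)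
open import Relation.Nullary using (¬_; Dec)
open import Relation.Binary.PropositionalEquality using (_≡_; _≢_)
open import Function.Definitions using (Injective)

record Graph (n : ℕ) : Set₁ where
  field
    Adj     : Fin n → Fin n → Set
    adj?    : ∀ u v → Dec (Adj u v)
    sym     : ∀ {u v} → Adj u v → Adj v u
    irrefl  : ∀ {u} → ¬ Adj u u

module _ {n : ℕ} (G : Graph n) where
  open Graph G

  IsClique : (Fin n → Set) → Set
  IsClique A = ∀ u v → A u → A v → u ≢ v → Adj u v

  Special : (Fin n → Set) → (Fin n → Set) → Set
  Special A B =
    (∀ a b b′ → A a → B b → B b′ → Adj a b → Adj a b′ → b ≡ b′) ×
    (∀ b a a′ → B b → A a → A a′ → Adj b a → Adj b a′ → a ≡ a′)

  Graded : (Fin n → Set) → (Fin n → Set) → Set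
  Graded A B = IsClique A × IsClique B × Special A B

  Class : (Fin n → Fin 3) → Fin 3 → Fin n → Set
  Class p i v = p v ≡ i

  -- G is good: V(G) is partitioned into Q₁,Q₂,Q₃ (the classes of a
  -- labelling p : Fin n → Fin 3; classes may be empty) with all three
  -- pairs graded
  IsGood : Set
  IsGood = Σ (Fin n → Fin 3) λ p →
    Graded (Class p Fin.zero) (Class p (Fin.suc Fin.zero)) ×
    Graded (Class p (Fin.suc Fin.zero)) (Class p (Fin.suc (Fin.suc Fin.zero))) ×
    Graded (Class p (Fin.suc (Fin.suc Fin.zero))) (Class p Fin.zero)

  HasCliqueOfSize : ℕ → Set
  HasCliqueOfSize k = Σ (Fin k → Fin n) λ f →
    Injective _≡_ _≡_ f × (∀ i j → i ≢ j → Adj (f i) (f j))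

  CliqueNumber : ℕ → Set
  CliqueNumber w = HasCliqueOfSize w × (∀ k → HasCliqueOfSize k → k ≤ w)

  Colourable : ℕ → Set
  Colourable k = Σ (Fin n → Fin k) λ c → ∀ u v → Adj u v → c u ≢ c v

  ChromaticNumber : ℕ → Set
  ChromaticNumber k = Colourable k × (∀ j → Colourable j → k ≤ j)

-- Colour the vertices greedily. A vertex v of class Qᵢ whose already coloured
-- neighbours see all ω colours is handled by a swap: Qᵢ (a clique, together
-- with v) misses some colour m, carried by the unique neighbour z of v in a
-- second class Qⱼ. Since ω ≥ 4 there is a colour d different from m, from the
-- colour of the unique neighbour of v in the third class Qₖ, and from the
-- colour of the Qᵢ-neighbour of the Qₖ-vertex coloured m. The neighbour u of v
-- coloured d lies in Qᵢ, and recolouring u with m and then v with d is proper.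
module Submission where

open import Data.Empty using (⊥-elim)
open import Data.Fin using (Fin; zero; suc; toℕ; fromℕ<)
open import Data.Fin.Patterns using (0F; 1F; 2F)
open import Data.Fin.Properties
  using (_≟_; any?; all?; ¬∀⟶∃¬; injective⇒≤; toℕ<n; toℕ-injective; toℕ-fromℕ<)
open import Data.List using (List; []; _∷_; length; lookup)
open import Data.List.Membership.Propositional using () renaming (_∈_ to _∈ₗ_; _∉_ to _∉ₗ_)
import Data.List.Membership.DecPropositional as DecMembership
open import Data.List.Relation.Unary.Any using (here; there; index)
open import Data.List.Relation.Unary.Any.Properties using (lookup-index)
open import Data.Nat as ℕ using (ℕ; _≤_; _<_; _<?_; s≤s; z≤n)
open import Data.Nat.Properties using (≤-trans; ≤-refl; <⇒≤; 1+n≰n; <-irrefl; m<1+n⇒m<n∨m≡n)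
open import Data.Product using (Σ; ∃; _×_; _,_; proj₁; proj₂; swap)
open import Data.Sum using (_⊎_; inj₁; inj₂; map₁)
open import Data.Vec.Functional using (updateAt)
open import Data.Vec.Functional.Properties using (updateAt-updates; updateAt-minimal)
open import Function using (const; _∘_)
open import Function.Definitions using (Injective)
open import Relation.Nullary using (¬_; yes; no)
open import Relation.Nullary.Decidable using (_×-dec_)
open import Relation.Unary using (Decidable; _∉_; _⊆_; _∪_; ｛_｝)
open import Relation.Binary.PropositionalEquality
  using (_≡_; _≢_; refl; sym; trans; cong; subst)

open import Defs

length<⇒∃∉ : ∀ {w} (xs : List (Fin w)) → length xs < w → ∃ λ d → d ∉ₗ xs
length<⇒∃∉ {w} xs |xs|<w = ¬∀⟶∃¬ w (_∈ₗ xs) (_∈? xs) not-covering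
  where
  open DecMembership (_≟_ {w}) using (_∈?_)

  not-covering : ¬ (∀ d → d ∈ₗ xs)
  not-covering d∈xs = 1+n≰n (≤-trans |xs|<w (injective⇒≤ index-injective))
    where
    index-injective : Injective _≡_ _≡_ (index ∘ d∈xs)
    index-injective {d} {d′} same-index =
      trans (lookup-index (d∈xs d))
            (trans (cong (lookup xs) same-index) (sym (lookup-index (d∈xs d′))))

constant-on-subsingleton : ∀ {n} {A : Set} {Q : Fin n → Set} → A → Decidable Q →
  (∀ {x y} → Q x → Q y → x ≡ y) → (f : Fin n → A) → ∃ λ b → ∀ x → Q x → f x ≡ b
constant-on-subsingleton default Q? unique f with any? Q?
... | yes (x , qx) = f x , λ y qy → cong f (unique qy qx)
... | no ¬∃Q = default , λ y qy → ⊥-elim (¬∃Q (y , qy))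

outside-singleton : ∀ {A : Set} {S : A → Set} {v x} → (S ∪ ｛ v ｝) x → x ≢ v → S x
outside-singleton (inj₁ sx) _ = sx
outside-singleton (inj₂ v≡x) x≢v = ⊥-elim (x≢v (sym v≡x))

third-label : (i j : Fin 3) → i ≢ j → ∃ λ k → k ≢ i × (∀ l → l ≡ i ⊎ l ≡ j ⊎ l ≡ k)
third-label 0F 0F i≢j = ⊥-elim (i≢j refl)
third-label 0F 1F _ = 2F , (λ ()) , λ { 0F → inj₁ refl ; 1F → inj₂ (inj₁ refl) ; 2F → inj₂ (inj₂ refl) }
third-label 0F 2F _ = 1F , (λ ()) , λ { 0F → inj₁ refl ; 1F → inj₂ (inj₂ refl) ; 2F → inj₂ (inj₁ refl) }
third-label 1F 0F _ = 2F , (λ ()) , λ { 0F → inj₂ (inj₁ refl) ; 1F → inj₁ refl ; 2F → inj₂ (inj₂ refl) }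
third-label 1F 1F i≢j = ⊥-elim (i≢j refl)
third-label 1F 2F _ = 0F , (λ ()) , λ { 0F → inj₂ (inj₂ refl) ; 1F → inj₁ refl ; 2F → inj₂ (inj₁ refl) }
third-label 2F 0F _ = 1F , (λ ()) , λ { 0F → inj₂ (inj₁ refl) ; 1F → inj₂ (inj₂ refl) ; 2F → inj₁ refl }
third-label 2F 1F _ = 0F , (λ ()) , λ { 0F → inj₂ (inj₂ refl) ; 1F → inj₂ (inj₁ refl) ; 2F → inj₁ refl }
third-label 2F 2F i≢j = ⊥-elim (i≢j refl)

module _ {n : ℕ} (G : Graph n) where
  open Graph G renaming (sym to adj-sym)

  ProperOn : ∀ {w} → (Fin n → Set) → (Fin n → Fin w) → Set
  ProperOn S c = ∀ a b → S a → S b → Adj a b → c a ≢ c b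

  ColourNear : ∀ {w} → (Fin n → Set) → (Fin n → Fin w) → Fin n → Fin w → Set
  ColourNear S c v d = ∃ λ u → S u × Adj v u × c u ≡ d

  colourNear? : ∀ {w} {S : Fin n → Set} → Decidable S → (c : Fin n → Fin w) → ∀ v →
    Decidable (ColourNear S c v)
  colourNear? S? c v d = any? λ u → S? u ×-dec adj? v u ×-dec (c u ≟ d)

  proper-⊆ : ∀ {w} {S T : Fin n → Set} {c : Fin n → Fin w} →
    T ⊆ S → ProperOn S c → ProperOn T c
  proper-⊆ T⊆S proper a b ta tb = proper a b (T⊆S ta) (T⊆S tb)

  proper-assign : ∀ {w} {S : Fin n → Set} {c : Fin n → Fin w} {v d} → ProperOn S c →
    (∀ b → S b → b ≢ v → Adj v b → c b ≢ d) →
    ProperOn (S ∪ ｛ v ｝) (updateAt c v (const d))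
  proper-assign {w} {S} {c} {v} {d} proper avoids = proper′
    where
    c′ : Fin n → Fin w
    c′ = updateAt c v (const d)

    old : ∀ {x} → (S ∪ ｛ v ｝) x → x ≢ v → S x
    old = outside-singleton {S = S}

    unchanged : ∀ {x} → x ≢ v → c′ x ≡ c x
    unchanged {x} x≢v = updateAt-minimal x v c x≢v

    proper′ : ProperOn (S ∪ ｛ v ｝) c′
    proper′ a b sa sb ab with a ≟ v | b ≟ v
    ... | yes refl | yes refl = ⊥-elim (irrefl ab)
    ... | yes refl | no b≢v = λ d≡cb →
      avoids b (old sb b≢v) b≢v ab (trans (sym (unchanged b≢v)) (trans (sym d≡cb) (updateAt-updates v c)))
    ... | no a≢v | yes refl = λ ca≡d →
      avoids a (old sa a≢v) a≢v (adj-sym ab) (trans (sym (unchanged a≢v)) (trans ca≡d (updateAt-updates v c)))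
    ... | no a≢v | no b≢v = λ ca≡cb →
      proper a b (old sa a≢v) (old sb b≢v) ab (trans (sym (unchanged a≢v)) (trans ca≡cb (unchanged b≢v)))

  proper-injective-on-clique : ∀ {w} {S C : Fin n → Set} {c : Fin n → Fin w} →
    IsClique G C → ProperOn S c → ∀ {a b} → S a → S b → C a → C b → c a ≡ c b → a ≡ b
  proper-injective-on-clique clique proper {a} {b} sa sb ca cb same-colour with a ≟ b
  ... | yes a≡b = a≡b
  ... | no a≢b = ⊥-elim (proper a b sa sb (clique a b ca cb a≢b) same-colour)

  clique-size≤colours : ∀ {k j} → HasCliqueOfSize G k → Colourable G j → k ≤ j
  clique-size≤colours (f , _ , f-adj) (c , proper) = injective⇒≤ colour-injective
    where
    colour-injective : Injective _≡_ _≡_ (c ∘ f)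
    colour-injective {a} {b} same-colour with a ≟ b
    ... | yes a≡b = a≡b
    ... | no a≢b = ⊥-elim (proper (f a) (f b) (f-adj a b a≢b) same-colour)

  -- The coloured part of C together with v would otherwise be a clique of size w + 1.
  clique-misses-colour : ∀ {w} → (∀ k → HasCliqueOfSize G k → k ≤ w) →
    ∀ {S C : Fin n → Set} → Decidable S → Decidable C → IsClique G C →
    ∀ {c : Fin n → Fin w} → ProperOn S c → ∀ {v} → C v → v ∉ S →
    ∃ λ m → ∀ x → S x → C x → c x ≢ m
  clique-misses-colour {w} ω≤w {S} {C} S? C? clique {c} proper {v} cv v∉S =
    let m , unused = ¬∀⟶∃¬ w Used Used? not-all-used
    in m , λ x sx cx cx≡m → unused (x , sx , cx , cx≡m)
    where
    Used : Fin w → Set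
    Used m = ∃ λ x → S x × C x × c x ≡ m

    Used? : Decidable Used
    Used? m = any? λ x → S? x ×-dec C? x ×-dec (c x ≟ m)

    not-all-used : ¬ (∀ m → Used m)
    not-all-used used = 1+n≰n (ω≤w _ (f , f-injective , f-adj))
      where
      x : Fin w → Fin n
      x m = proj₁ (used m)

      x∈S : ∀ m → S (x m)
      x∈S m = proj₁ (proj₂ (used m))

      x∈C : ∀ m → C (x m)
      x∈C m = proj₁ (proj₂ (proj₂ (used m)))

      cx≡m : ∀ m → c (x m) ≡ m
      cx≡m m = proj₂ (proj₂ (proj₂ (used m)))

      f : Fin (ℕ.suc w) → Fin n
      f zero = v
      f (suc m) = x m

      f-in-C : ∀ a → C (f a)
      f-in-C zero = cv
      f-in-C (suc m) = x∈C m

      v≢x : ∀ m → v ≢ x m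
      v≢x m v≡x = v∉S (subst S (sym v≡x) (x∈S m))

      f-injective : Injective _≡_ _≡_ f
      f-injective {zero} {zero} _ = refl
      f-injective {zero} {suc m} v≡x = ⊥-elim (v≢x m v≡x)
      f-injective {suc m} {zero} x≡v = ⊥-elim (v≢x m (sym x≡v))
      f-injective {suc m} {suc m′} x≡x′ = cong suc (trans (sym (cx≡m m)) (trans (cong c x≡x′) (cx≡m m′)))

      f-adj : ∀ a b → a ≢ b → Adj (f a) (f b)
      f-adj a b a≢b = clique (f a) (f b) (f-in-C a) (f-in-C b) (a≢b ∘ f-injective)

good-labelling : ∀ {n} (G : Graph n) → IsGood G → Σ (Fin n → Fin 3) λ p →
  (∀ i → IsClique G (Class G p i)) × (∀ i j → i ≢ j → Special G (Class G p i) (Class G p j))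
good-labelling G
  (p , (clique₀ , clique₁ , special₀₁) , (_ , clique₂ , special₁₂) , (_ , _ , special₂₀)) =
  p , clique , special
  where
  clique : ∀ i → IsClique G (Class G p i)
  clique 0F = clique₀
  clique 1F = clique₁
  clique 2F = clique₂

  special : ∀ i j → i ≢ j → Special G (Class G p i) (Class G p j)
  special 0F 0F i≢j = ⊥-elim (i≢j refl)
  special 0F 1F _ = special₀₁
  special 0F 2F _ = swap special₂₀
  special 1F 0F _ = swap special₀₁
  special 1F 1F i≢j = ⊥-elim (i≢j refl)
  special 1F 2F _ = special₁₂
  special 2F 0F _ = special₂₀
  special 2F 1F _ = swap special₁₂
  special 2F 2F i≢j = ⊥-elim (i≢j refl)

module GoodLabelling {n : ℕ} (G : Graph n) (p : Fin n → Fin 3)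
  (clique : ∀ i → IsClique G (Class G p i))
  (special : ∀ i j → i ≢ j → Special G (Class G p i) (Class G p j)) where
  open Graph G renaming (sym to adj-sym)

  unique-neighbour-in-class : ∀ {a b b′ l} → p a ≢ l → p b ≡ l → p b′ ≡ l →
    Adj a b → Adj a b′ → b ≡ b′
  unique-neighbour-in-class {a} pa≢l pb≡l pb′≡l =
    proj₁ (special (p a) _ pa≢l) a _ _ refl pb≡l pb′≡l

  module _ {w : ℕ} (default : Fin w) where

    neighbours-in-class-share-colour : (c : Fin n → Fin w) → ∀ {a l} → p a ≢ l →
      ∃ λ b → ∀ y → Adj a y → p y ≡ l → c y ≡ b
    neighbours-in-class-share-colour c {a} {l} pa≢l =
      let b , constant = constant-on-subsingleton default
                           (λ y → adj? a y ×-dec (p y ≟ l)) unique c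
      in b , λ y ay py≡l → constant y (ay , py≡l)
      where
      unique : ∀ {y y′} → Adj a y × p y ≡ l → Adj a y′ × p y′ ≡ l → y ≡ y′
      unique (ay , py≡l) (ay′ , py′≡l) = unique-neighbour-in-class pa≢l py≡l py′≡l ay ay′

    neighbours-of-colour-in-class-share-colour : ∀ {S} → Decidable S →
      ∀ {c : Fin n → Fin w} → ProperOn G S c → ∀ {i k} → k ≢ i → (m : Fin w) →
      ∃ λ b → ∀ x y → p x ≡ i → S y → p y ≡ k → c y ≡ m → Adj x y → c x ≡ b
    neighbours-of-colour-in-class-share-colour {S} S? {c} proper {i} {k} k≢i m =
      let b , constant = constant-on-subsingleton default Near? unique c
      in b , λ x y px≡i sy py≡k cy≡m xy → constant x (px≡i , y , sy , py≡k , cy≡m , xy)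
      where
      Near : Fin n → Set
      Near x = p x ≡ i × ∃ λ y → S y × p y ≡ k × c y ≡ m × Adj x y

      Near? : Decidable Near
      Near? x = (p x ≟ i) ×-dec any? λ y → S? y ×-dec (p y ≟ k) ×-dec (c y ≟ m) ×-dec adj? x y

      unique : ∀ {x x′} → Near x → Near x′ → x ≡ x′
      unique (px≡i , y , sy , py≡k , cy≡m , xy) (px′≡i , y′ , sy′ , py′≡k , cy′≡m , x′y′)
        with refl ← proper-injective-on-clique G (clique k) proper sy sy′ py≡k py′≡k
                      (trans cy≡m (sym cy′≡m))
        = unique-neighbour-in-class (λ py≡i → k≢i (trans (sym py≡k) py≡i)) px≡i px′≡i
            (adj-sym xy) (adj-sym x′y′)

  swap-extension : ∀ {w S} {c : Fin n → Fin w} → ProperOn G S c → ∀ {v m z k b₁ b₂ u} → v ∉ S →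
    (∀ x → S x → p x ≡ p v → c x ≢ m) → S z → Adj v z → c z ≡ m → p v ≢ p z →
    (∀ l → l ≡ p v ⊎ l ≡ p z ⊎ l ≡ k) →
    (∀ y → Adj v y → p y ≡ k → c y ≡ b₁) →
    (∀ x y → p x ≡ p v → S y → p y ≡ k → c y ≡ m → Adj x y → c x ≡ b₂) →
    S u → Adj v u → c u ∉ₗ m ∷ b₁ ∷ b₂ ∷ [] →
    ∃ λ c′ → ProperOn G (S ∪ ｛ v ｝) c′
  swap-extension {w} {S} {c} proper {v} {m} {z} {_} {b₁} {b₂} {u} v∉S m∉class z∈S vz cz≡m i≢j
    trichotomy b₁-colour b₂-colour u∈S vu cu∉ =
    updateAt c″ v (const (c u)) ,
    proper-⊆ G (map₁ inj₁) (proper-assign G (proper-assign G proper m-free-near-u) cu-free-near-v)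
    where
    cu≢m : c u ≢ m
    cu≢m = cu∉ ∘ here

    cu≢b₁ : c u ≢ b₁
    cu≢b₁ = cu∉ ∘ there ∘ here

    cu≢b₂ : c u ≢ b₂
    cu≢b₂ = cu∉ ∘ there ∘ there ∘ here

    neighbour-in-j-is-z : ∀ {b} → Adj v b → p b ≡ p z → b ≡ z
    neighbour-in-j-is-z vb pb≡j = unique-neighbour-in-class i≢j pb≡j refl vb vz

    u-in-i : p u ≡ p v
    u-in-i with trichotomy (p u)
    ... | inj₁ pu≡i = pu≡i
    ... | inj₂ (inj₁ pu≡j) = ⊥-elim (cu≢m (trans (cong c (neighbour-in-j-is-z vu pu≡j)) cz≡m))
    ... | inj₂ (inj₂ pu≡k) = ⊥-elim (cu≢b₁ (b₁-colour u vu pu≡k))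

    m-free-near-u : ∀ b → S b → b ≢ u → Adj u b → c b ≢ m
    m-free-near-u b sb _ ub with trichotomy (p b)
    ... | inj₁ pb≡i = m∉class b sb pb≡i
    ... | inj₂ (inj₁ pb≡j) = λ cb≡m →
      let b≡z = proper-injective-on-clique G (clique (p z)) proper sb z∈S pb≡j refl
                  (trans cb≡m (sym cz≡m))
          u≡v = unique-neighbour-in-class (i≢j ∘ sym) u-in-i refl
                  (adj-sym (subst (Adj u) b≡z ub)) (adj-sym vz)
      in v∉S (subst S u≡v u∈S)
    ... | inj₂ (inj₂ pb≡k) = λ cb≡m → cu≢b₂ (b₂-colour u b u-in-i sb pb≡k cb≡m ub)

    cu-free-near-v-in-S : ∀ b → S b → b ≢ u → Adj v b → c b ≢ c u
    cu-free-near-v-in-S b sb b≢u vb with trichotomy (p b)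
    ... | inj₁ pb≡i = proper b u sb u∈S (clique (p v) b u pb≡i u-in-i b≢u)
    ... | inj₂ (inj₁ pb≡j) = λ cb≡cu →
      cu≢m (trans (sym cb≡cu) (trans (cong c (neighbour-in-j-is-z vb pb≡j)) cz≡m))
    ... | inj₂ (inj₂ pb≡k) = λ cb≡cu → cu≢b₁ (trans (sym cb≡cu) (b₁-colour b vb pb≡k))

    c″ : Fin n → Fin w
    c″ = updateAt c u (const m)

    cu-free-near-v : ∀ b → (S ∪ ｛ u ｝) b → b ≢ v → Adj v b → c″ b ≢ c u
    cu-free-near-v b sb _ vb with b ≟ u
    ... | yes refl = λ m≡cu → cu≢m (trans (sym m≡cu) (updateAt-updates u c))
    ... | no b≢u = λ cb≡cu →
      cu-free-near-v-in-S b (outside-singleton {S = S} sb b≢u) b≢u vb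
        (trans (sym (updateAt-minimal b u c b≢u)) cb≡cu)

  module _ {w : ℕ} (ω≤w : ∀ k → HasCliqueOfSize G k → k ≤ w) (4≤w : 4 ≤ w) where

    colour₀ : Fin w
    colour₀ = fromℕ< (≤-trans (s≤s z≤n) 4≤w)

    extend : ∀ {S} → Decidable S → ∀ {c : Fin n → Fin w} → ProperOn G S c → ∀ {v} → v ∉ S →
      ∃ λ c′ → ProperOn G (S ∪ ｛ v ｝) c′
    extend S? {c} proper {v} v∉S with all? (colourNear? G S? c v)
    ... | no unsaturated =
      let d , d-free = ¬∀⟶∃¬ w _ (colourNear? G S? c v) unsaturated
      in updateAt c v (const d) , proper-assign G proper λ b sb _ vb cb≡d → d-free (b , sb , vb , cb≡d)
    ... | yes saturated =
      let m , m∉class = clique-misses-colour G ω≤w S? (λ x → p x ≟ p v) (clique (p v))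
                          proper refl v∉S
          z , z∈S , vz , cz≡m = saturated m
          i≢j = λ i≡j → m∉class z z∈S (sym i≡j) cz≡m
          k , k≢i , trichotomy = third-label (p v) (p z) i≢j
          b₁ , b₁-colour = neighbours-in-class-share-colour colour₀ c {a = v} (k≢i ∘ sym)
          b₂ , b₂-colour = neighbours-of-colour-in-class-share-colour colour₀ S? proper k≢i m
          d , d∉ = length<⇒∃∉ (m ∷ b₁ ∷ b₂ ∷ []) 4≤w
          u , u∈S , vu , cu≡d = saturated d
      in swap-extension proper v∉S m∉class z∈S vz cz≡m i≢j trichotomy b₁-colour b₂-colour
           u∈S vu (subst (_∉ₗ m ∷ b₁ ∷ b₂ ∷ []) (sym cu≡d) d∉)

    proper-on-prefix : ∀ t → t ≤ n → ∃ λ c → ProperOn G (λ x → toℕ x < t) c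
    proper-on-prefix ℕ.zero _ = const colour₀ , λ _ _ ()
    proper-on-prefix (ℕ.suc t) t<n =
      let c , proper = proper-on-prefix t (<⇒≤ t<n)
          c′ , proper′ = extend (λ x → toℕ x <? t) proper {v = fromℕ< t<n}
                           (<-irrefl (toℕ-fromℕ< t<n))
      in c′ , proper-⊆ G prefix-step proper′
      where
      prefix-step : ∀ {x} → toℕ x < ℕ.suc t → toℕ x < t ⊎ fromℕ< t<n ≡ x
      prefix-step x<1+t with m<1+n⇒m<n∨m≡n x<1+t
      ... | inj₁ x<t = inj₁ x<t
      ... | inj₂ x≡t = inj₂ (toℕ-injective (trans (toℕ-fromℕ< t<n) (sym x≡t)))

    colourable : Colourable G w
    colourable =
      let c , proper = proper-on-prefix n ≤-refl
      in c , λ a b → proper a b (toℕ<n a) (toℕ<n b)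

theorem2p2 : ∀ {n} (G : Graph n) → IsGood G → ∀ w → CliqueNumber G w → 4 ≤ w →
    ChromaticNumber G w
theorem2p2 G good _ (ω-clique , ω-maximal) 4≤w =
  let p , clique , special = good-labelling G good
  in GoodLabelling.colourable G p clique special ω-maximal 4≤w ,
     λ _ → clique-size≤colours G ω-clique
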